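{- Let $t$ be an odd positive integer and $n$ a positive integer, and let $$\theta_t(n) = \sqrt{\frac{2n}{t} + \frac14} + \frac12, \qquad \psi_t(n) = \sqrt{2nt + \left(\frac{t-2}{2}\right)^2} - \frac{t-2}{2}.$$ Then the number of representations of $n$ as a positive trapezoid with difference $t$ is $$\Phi_t^+(n) = d_1(n) + d_1(n,\theta_t(n)) - d_1(n,\psi_t(n)).$$
   Context: For $k \in \mathbb{N}$, $t \in \mathbb{N}_0$, $a \in \mathbb{Z}$, let $s_{k,t}(a) = \sum_{i=0}^{k-1}(a+it) = ka + \frac{k(k-1)t}{2}$. Define $\Phi_t^+(n) = |\{(k,a) \in \mathbb{N}\times\mathbb{N} : s_{k,t}(a) = n\}|$, the number of representations of $n$ as a sum of a finite arithmetic progression with difference $t$ all of whose terms are positive integers. $d_1(n)$ is the number of odd positive divisors of $n$, and for a real number $x$, $d_1(n,x)$ is the number of odd positive divisors $d$ of $n$ with $d < x$. -}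

module Defs where

open import Data.Nat as ℕ using (ℕ; zero; suc; _+_; _*_; NonZero)
open import Data.Nat.Divisibility using (_∣_; _∣?_)
open import Data.Integer as ℤ using (ℤ; +_)
open import Data.Rational as ℚ using (ℚ; _/_; ½; 0ℚ)
open import Data.Rational.Properties as ℚP using ()
open import Data.List using (List; []; _∷_; length; filter; upTo; map; concatMap)
open import Data.Nat.ListAction using (sum)
open import Data.Product using (_×_; _,_; proj₁; proj₂)
open import Data.Sum using (_⊎_)
open import Relation.Nullary using (Dec; ¬_; ¬?)
open import Relation.Nullary.Decidable using (_⊎-dec_; _×-dec_)
open import Relation.Unary using (Pred; Decidable)
open import Relation.Binary.PropositionalEquality using (_≡_)
open import Level using (0ℓ)

s : ℕ → ℕ → ℕ → ℕ
s k t a = sum (map (λ i → a + i * t) (upTo k))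

range1 : ℕ → List ℕ
range1 n = map suc (upTo n)

-- Φ_t^+(n) = #{(k,a) ∈ ℕ⁺ × ℕ⁺ : s_{k,t}(a) = n}.
-- Every such pair has 1 ≤ k ≤ n and 1 ≤ a ≤ n (since s_{k,t}(a) ≥ k a),
-- so the set is enumerated over [1..n] × [1..n].
pairs : ℕ → List (ℕ × ℕ)
pairs n = concatMap (λ k → map (λ a → (k , a)) (range1 n)) (range1 n)

Phi⁺ : ℕ → ℕ → ℕ
Phi⁺ t n = length (filter (λ p → s (proj₁ p) t (proj₂ p) ℕ.≟ n) (pairs n))

Odd : ℕ → Set
Odd d = ¬ (2 ∣ d)

odd? : Decidable Odd
odd? d = ¬? (2 ∣? d)

-- odd positive divisors of n (n ≥ 1), all lie in [1..n]
oddDivisors : ℕ → List ℕ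
oddDivisors n = filter (λ d → odd? d ×-dec (d ∣? n)) (range1 n)

d₁ : ℕ → ℕ
d₁ n = length (oddDivisors n)

-- d_1(n, x) for a threshold given as a decidable predicate "d < x"
d₁< : ℕ → (P : Pred ℕ 0ℓ) → Decidable P → ℕ
d₁< n P P? = length (filter P? (oddDivisors n))

-- The real number √q + r (q, r ∈ ℚ, q ≥ 0) is not available in the library;
-- the relation  x < √q + r  is defined exactly as it unfolds over ℚ:
--   x < √q + r  ⇔  x - r < 0  or  (x - r)² < q.
_<√_+_ : ℚ → ℚ → ℚ → Set
x <√ q + r = (x ℚ.- r ℚ.< 0ℚ) ⊎ ((x ℚ.- r) ℚ.* (x ℚ.- r) ℚ.< q)

_<√?_+_ : (x q r : ℚ) → Dec (x <√ q + r)
x <√? q + r = (x ℚ.- r ℚP.<? 0ℚ) ⊎-dec ((x ℚ.- r) ℚ.* (x ℚ.- r) ℚP.<? q)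

ℕtoℚ : ℕ → ℚ
ℕtoℚ m = + m / 1

-- θ_t(n) = √(2n/t + 1/4) + 1/2 : given by radicand and offset
θ-rad : (t n : ℕ) → .{{NonZero t}} → ℚ
θ-rad t n = (+ (2 * n) / t) ℚ.+ (+ 1 / 4)

θ-off : ℚ
θ-off = ½

-- ψ_t(n) = √(2nt + ((t-2)/2)²) - (t-2)/2
half-t-2 : ℕ → ℚ
half-t-2 t = (+ t ℤ.- + 2) / 2

ψ-rad : ℕ → ℕ → ℚ
ψ-rad t n = (+ (2 * n * t) / 1) ℚ.+ (half-t-2 t ℚ.* half-t-2 t)

ψ-off : ℕ → ℚ
ψ-off t = ℚ.- half-t-2 t

d₁θ : (t n : ℕ) → .{{NonZero t}} → ℕ
d₁θ t n = d₁< n (λ d → ℕtoℚ d <√ θ-rad t n + θ-off) (λ d → ℕtoℚ d <√? θ-rad t n + θ-off)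

d₁ψ : ℕ → ℕ → ℕ
d₁ψ t n = d₁< n (λ d → ℕtoℚ d <√ ψ-rad t n + ψ-off t) (λ d → ℕtoℚ d <√? ψ-rad t n + ψ-off t)

-- Since 2 s_{k,t}(a) = k (2a + (k - 1) t) and t is odd, the two factors k and
-- 2a + (k - 1) t have opposite parity, so each representation (k , a) of n is
-- labelled by an odd divisor d of n: either its length k = d, or its
-- first-plus-last term 2a + (k - 1) t = d with k = 2n / d.  Conversely an odd
-- divisor d is the length of exactly one representation when d (d - 1) t < 2n,
-- i.e. d < θ_t(n), and the first-plus-last term of exactly one representation
-- when 2nt + 2d ≤ d (d + t), i.e. d ≥ ψ_t(n).
module Submission where

open import Defs
open import Data.Nat as ℕ using (ℕ; NonZero)
open import Relation.Binary.PropositionalEquality using (_≡_)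

-- The development lives in an anonymous module so that the ℕ operators it opens
-- do not clash with the ℤ operators of the final statement.
module _ where
  open import Data.Nat using (zero; suc; _+_; _*_; _∸_; _≤_; _<_; z≤n; s≤s)
  open import Data.Nat.Properties as ℕP using ()
  open import Data.Nat.Divisibility using (_∣_; _∣?_; divides; ∣m∣n⇒∣m+n; ∣⇒≤)
  open import Data.Nat.ListAction using (sum)
  open import Data.Nat.ListAction.Properties using (sum-++)
  open import Data.Nat.Tactic.RingSolver using (solve-∀)
  open import Data.Integer as ℤ using ()
  open import Data.Integer.Properties as ℤP using ()
  open import Data.Rational as ℚ using (0ℚ)
  open import Data.Rational.Properties as ℚP using ()
  open import Data.Rational.Unnormalised as ℚᵘ using (ℚᵘ; mkℚᵘ; ↥_; ↧_; _≃_; 0ℚᵘ)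
  open import Data.Rational.Unnormalised.Properties as ℚᵘP using ()
  open import Data.Bool using (if_then_else_)
  open import Data.List using (List; []; _∷_; _++_; map; filter; length; upTo; concatMap; _∷ʳ_)
  open import Data.List.Properties using (upTo-∷ʳ; map-++; map-∘; map-cong)
  open import Data.Product using (_×_; _,_; proj₁; proj₂; ∃-syntax)
  open import Data.Sum using (_⊎_; inj₁; inj₂; [_,_])
  open import Function using (_∘_; _⇔_; mk⇔; Equivalence)
  open import Function.Properties.Equivalence using () renaming (trans to ⇔-trans)
  open import Level using (Level)
  open import Relation.Nullary using (Dec; yes; no; ¬_; does; contradiction)
  open import Relation.Nullary.Decidable using (_×-dec_; _⊎-dec_; decidable-stable)
  open import Relation.Unary using (Pred; Decidable)
  open import Relation.Binary.PropositionalEquality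
    using (refl; sym; trans; cong; cong₂; subst; subst₂; _≢_; ≢-sym; module ≡-Reasoning)

  private variable
    ℓ : Level
    A B : Set
    P Q : Set ℓ
    a n : ℕ

  𝟙 : Dec P → ℕ
  𝟙 P? = if does P? then 1 else 0

  𝟙-yes : (P? : Dec P) → P → 𝟙 P? ≡ 1
  𝟙-yes (yes _) _ = refl
  𝟙-yes (no ¬p) p = contradiction p ¬p

  𝟙-no : (P? : Dec P) → ¬ P → 𝟙 P? ≡ 0
  𝟙-no (yes p) ¬p = contradiction p ¬p
  𝟙-no (no _) _ = refl

  𝟙-× : (P? : Dec P) (Q? : Dec Q) → 𝟙 (P? ×-dec Q?) ≡ 𝟙 P? * 𝟙 Q?
  𝟙-× (yes _) (yes _) = refl
  𝟙-× (yes _) (no _) = refl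
  𝟙-× (no _) _ = refl

  𝟙-⊎ : (P? : Dec P) (Q? : Dec Q) → ¬ (P × Q) → 𝟙 (P? ⊎-dec Q?) ≡ 𝟙 P? + 𝟙 Q?
  𝟙-⊎ (yes p) (yes q) ¬p×q = contradiction (p , q) ¬p×q
  𝟙-⊎ (yes _) (no _) _ = refl
  𝟙-⊎ (no _) (yes _) _ = refl
  𝟙-⊎ (no _) (no _) _ = refl

  𝟙-⇔ : (P? : Dec P) (Q? : Dec Q) → (P → Q) → (Q → P) → 𝟙 P? ≡ 𝟙 Q?
  𝟙-⇔ P? (yes q) _ Q⇒P = 𝟙-yes P? (Q⇒P q)
  𝟙-⇔ P? (no ¬q) P⇒Q _ = 𝟙-no P? (¬q ∘ P⇒Q)

  𝟙-complement : (P? : Dec P) (Q? : Dec Q) → (P → ¬ Q) → (¬ P → Q) → 𝟙 P? + 𝟙 Q? ≡ 1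
  𝟙-complement (yes p) Q? P⇒¬Q _ = cong suc (𝟙-no Q? (P⇒¬Q p))
  𝟙-complement (no ¬p) Q? _ ¬P⇒Q = 𝟙-yes Q? (¬P⇒Q ¬p)

  length-filter : {P : Pred A ℓ} (P? : Decidable P) (xs : List A) →
                  length (filter P? xs) ≡ sum (map (𝟙 ∘ P?) xs)
  length-filter P? [] = refl
  length-filter P? (x ∷ xs) with P? x
  ... | yes _ = cong suc (length-filter P? xs)
  ... | no _ = length-filter P? xs

  sum-map-filter : {P : Pred A ℓ} (P? : Decidable P) (f : A → ℕ) (xs : List A) →
                   sum (map f (filter P? xs)) ≡ sum (map (λ x → 𝟙 (P? x) * f x) xs)
  sum-map-filter P? f [] = refl
  sum-map-filter P? f (x ∷ xs) with P? x
  ... | yes _ = cong₂ _+_ (sym (ℕP.+-identityʳ (f x))) (sum-map-filter P? f xs)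
  ... | no _ = sum-map-filter P? f xs

  sum-map-concatMap : (f : B → ℕ) (g : A → List B) (xs : List A) →
                      sum (map f (concatMap g xs)) ≡ sum (map (λ x → sum (map f (g x))) xs)
  sum-map-concatMap f g [] = refl
  sum-map-concatMap f g (x ∷ xs) = begin
    sum (map f (g x ++ concatMap g xs))              ≡⟨ cong sum (map-++ f (g x) _) ⟩
    sum (map f (g x) ++ map f (concatMap g xs))      ≡⟨ sum-++ (map f (g x)) _ ⟩
    sum (map f (g x)) + sum (map f (concatMap g xs)) ≡⟨ cong (sum (map f (g x)) +_) (sum-map-concatMap f g xs) ⟩
    sum (map f (g x)) + sum (map (λ x → sum (map f (g x))) xs) ∎
    where open ≡-Reasoning

  1≤_≤_ : ℕ → ℕ → Set
  1≤ i ≤ n = 1 ≤ i × i ≤ n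

  ∑₁ : ℕ → (ℕ → ℕ) → ℕ
  ∑₁ zero f = 0
  ∑₁ (suc n) f = ∑₁ n f + f (suc n)

  syntax ∑₁ n (λ i → e) = ∑[ 1≤ i ≤ n ] e

  private
    range-weaken : ∀ {i} → 1≤ i ≤ n → 1≤ i ≤ suc n
    range-weaken (1≤i , i≤n) = 1≤i , ℕP.m≤n⇒m≤1+n i≤n

    range-top : ∀ n → 1≤ suc n ≤ suc n
    range-top n = s≤s z≤n , ℕP.≤-refl

  sum-map-range1 : (f : ℕ → ℕ) (n : ℕ) → sum (map f (range1 n)) ≡ ∑[ 1≤ i ≤ n ] f i
  sum-map-range1 f zero = refl
  sum-map-range1 f (suc n) = begin
    sum (map f (map suc (upTo (suc n))))    ≡⟨ cong (λ l → sum (map f (map suc l))) (sym (upTo-∷ʳ n)) ⟩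
    sum (map f (map suc (upTo n ∷ʳ n)))      ≡⟨ cong (λ l → sum (map f l)) (map-++ suc (upTo n) _) ⟩
    sum (map f (range1 n ∷ʳ suc n))          ≡⟨ cong sum (map-++ f (range1 n) _) ⟩
    sum (map f (range1 n) ++ f (suc n) ∷ []) ≡⟨ sum-++ (map f (range1 n)) _ ⟩
    sum (map f (range1 n)) + (f (suc n) + 0) ≡⟨ cong₂ _+_ (sum-map-range1 f n) (ℕP.+-identityʳ _) ⟩
    ∑[ 1≤ i ≤ n ] f i + f (suc n)            ∎
    where open ≡-Reasoning

  ∑₁-cong : ∀ n {f g : ℕ → ℕ} → (∀ i → 1≤ i ≤ n → f i ≡ g i) → ∑₁ n f ≡ ∑₁ n g
  ∑₁-cong zero f≗g = refl
  ∑₁-cong (suc n) f≗g = cong₂ _+_ (∑₁-cong n (λ i → f≗g i ∘ range-weaken)) (f≗g (suc n) (range-top n))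

  ∑₁-zero : ∀ n {f : ℕ → ℕ} → (∀ i → 1≤ i ≤ n → f i ≡ 0) → ∑₁ n f ≡ 0
  ∑₁-zero zero f≗0 = refl
  ∑₁-zero (suc n) f≗0 = cong₂ _+_ (∑₁-zero n (λ i → f≗0 i ∘ range-weaken)) (f≗0 (suc n) (range-top n))

  ∑₁-distrib-+ : ∀ n (f g : ℕ → ℕ) → ∑[ 1≤ i ≤ n ] (f i + g i) ≡ ∑₁ n f + ∑₁ n g
  ∑₁-distrib-+ zero f g = refl
  ∑₁-distrib-+ (suc n) f g rewrite ∑₁-distrib-+ n f g = interchange (∑₁ n f) (∑₁ n g) (f (suc n)) (g (suc n))
    where
    interchange : ∀ a b c d → a + b + (c + d) ≡ a + c + (b + d)
    interchange = solve-∀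

  ∑₁-comm : ∀ m n (f : ℕ → ℕ → ℕ) →
            ∑[ 1≤ i ≤ m ] ∑[ 1≤ j ≤ n ] f i j ≡ ∑[ 1≤ j ≤ n ] ∑[ 1≤ i ≤ m ] f i j
  ∑₁-comm zero n f = sym (∑₁-zero n (λ _ _ → refl))
  ∑₁-comm (suc m) n f = begin
    ∑[ 1≤ i ≤ m ] ∑[ 1≤ j ≤ n ] f i j + ∑[ 1≤ j ≤ n ] f (suc m) j
      ≡⟨ cong (_+ ∑₁ n (f (suc m))) (∑₁-comm m n f) ⟩
    ∑[ 1≤ j ≤ n ] ∑[ 1≤ i ≤ m ] f i j + ∑[ 1≤ j ≤ n ] f (suc m) j
      ≡⟨ sym (∑₁-distrib-+ n _ _) ⟩
    ∑[ 1≤ j ≤ n ] (∑[ 1≤ i ≤ m ] f i j + f (suc m) j) ∎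
    where open ≡-Reasoning

  ∑₁-single : ∀ n {f : ℕ → ℕ} k → 1≤ k ≤ n →
              (∀ i → 1≤ i ≤ n → i ≢ k → f i ≡ 0) → ∑₁ n f ≡ f k
  ∑₁-single zero k (1≤k , k≤0) _ = contradiction (ℕP.≤-trans 1≤k k≤0) λ ()
  ∑₁-single (suc n) {f} k (1≤k , k≤1+n) f≗0 with k ℕ.≟ suc n
  ... | yes refl = cong (_+ f (suc n)) (∑₁-zero n λ i (1≤i , i≤n) →
                     f≗0 i (1≤i , ℕP.m≤n⇒m≤1+n i≤n) (ℕP.<⇒≢ (s≤s i≤n)))
  ... | no k≢1+n = begin
    ∑₁ n f + f (suc n) ≡⟨ cong₂ _+_ (∑₁-single n k k∈ (λ i → f≗0 i ∘ range-weaken))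
                                    (f≗0 (suc n) (range-top n) (≢-sym k≢1+n)) ⟩
    f k + 0            ≡⟨ ℕP.+-identityʳ (f k) ⟩
    f k                ∎
    where
    open ≡-Reasoning
    k∈ : 1≤ k ≤ n
    k∈ = 1≤k , ℕP.≤-pred (ℕP.≤∧≢⇒< k≤1+n k≢1+n)

  ∑₁-𝟙-unique : ∀ n {P : Pred ℕ ℓ} (P? : Decidable P) (Q? : Dec Q) →
                (∀ {i j} → P i → P j → i ≡ j) →
                (∀ i → 1≤ i ≤ n → P i → Q) →
                (Q → ∃[ i ] (1≤ i ≤ n × P i)) →
                ∑[ 1≤ i ≤ n ] 𝟙 (P? i) ≡ 𝟙 Q?
  ∑₁-𝟙-unique n P? (no ¬q) _ sound _ = ∑₁-zero n λ i i∈ → 𝟙-no (P? i) (¬q ∘ sound i i∈)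
  ∑₁-𝟙-unique n P? (yes q) unique _ complete with complete q
  ... | k , k∈ , pk =
    trans (∑₁-single n k k∈ λ i _ i≢k → 𝟙-no (P? i) (i≢k ∘ λ pi → unique pi pk)) (𝟙-yes (P? k) pk)

  ∑₁²-𝟙-unique : ∀ n {P : ℕ → ℕ → Set ℓ} (P? : ∀ i j → Dec (P i j)) (Q? : Dec Q) →
                 (∀ {i j i′ j′} → P i j → P i′ j′ → i ≡ i′ × j ≡ j′) →
                 (∀ i j → 1≤ i ≤ n → 1≤ j ≤ n → P i j → Q) →
                 (Q → ∃[ i ] ∃[ j ] (1≤ i ≤ n × 1≤ j ≤ n × P i j)) →
                 ∑[ 1≤ i ≤ n ] ∑[ 1≤ j ≤ n ] 𝟙 (P? i j) ≡ 𝟙 Q?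
  ∑₁²-𝟙-unique n P? (no ¬q) _ sound _ =
    ∑₁-zero n λ i i∈ → ∑₁-zero n λ j j∈ → 𝟙-no (P? i j) (¬q ∘ sound i j i∈ j∈)
  ∑₁²-𝟙-unique n P? (yes q) unique _ complete with complete q
  ... | k , l , k∈ , l∈ , pkl = begin
    ∑[ 1≤ i ≤ n ] ∑[ 1≤ j ≤ n ] 𝟙 (P? i j)
      ≡⟨ ∑₁-single n k k∈ (λ i _ i≢k → ∑₁-zero n λ j _ →
           𝟙-no (P? i j) λ pij → i≢k (proj₁ (unique pij pkl))) ⟩
    ∑[ 1≤ j ≤ n ] 𝟙 (P? k j)
      ≡⟨ ∑₁-single n l l∈ (λ j _ j≢l → 𝟙-no (P? k j) λ pkj → j≢l (proj₂ (unique pkj pkl))) ⟩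
    𝟙 (P? k l)
      ≡⟨ 𝟙-yes (P? k l) pkl ⟩
    1 ∎
    where open ≡-Reasoning

  even-or-odd : ∀ x → (∃[ q ] x ≡ 2 * q) ⊎ (∃[ q ] x ≡ suc (2 * q))
  even-or-odd zero = inj₁ (0 , refl)
  even-or-odd (suc x) with even-or-odd x
  ... | inj₁ (q , refl) = inj₂ (q , refl)
  ... | inj₂ (q , refl) = inj₁ (suc q , sym (ℕP.*-distribˡ-+ 2 1 q))

  odd-1+2* : ∀ q → Odd (suc (2 * q))
  odd-1+2* q (divides r eq) = ℕP.even≢odd r q (trans (ℕP.*-comm 2 r) (sym eq))

  odd⇒1+2* : ∀ {x} → Odd x → ∃[ q ] x ≡ suc (2 * q)
  odd⇒1+2* {x} x-odd with even-or-odd x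
  ... | inj₁ (q , refl) = contradiction (divides q (ℕP.*-comm 2 q)) x-odd
  ... | inj₂ x≡1+2q = x≡1+2q

  even⇒2* : ∀ {x} → ¬ Odd x → ∃[ q ] x ≡ 2 * q
  even⇒2* {x} x-even with even-or-odd x
  ... | inj₁ x≡2q = x≡2q
  ... | inj₂ (q , refl) = contradiction (odd-1+2* q) x-even

  odd⇒nonZero : ∀ {x} → Odd x → NonZero x
  odd⇒nonZero {zero} 0-odd = contradiction (divides 0 refl) 0-odd
  odd⇒nonZero {suc x} _ = _

  odd-+-odd⇒even : ∀ {x y} → Odd (x + y) → Odd x → ¬ Odd y
  odd-+-odd⇒even {x} {y} x+y-odd x-odd y-odd with odd⇒1+2* x-odd | odd⇒1+2* y-odd
  ... | q , refl | r , refl = x+y-odd (divides (suc (q + r)) (sum-of-odds q r))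
    where
    sum-of-odds : ∀ q r → suc (2 * q) + suc (2 * r) ≡ suc (q + r) * 2
    sum-of-odds = solve-∀

  odd-+-even⇒odd : ∀ {x y} → Odd (x + y) → ¬ Odd x → Odd y
  odd-+-even⇒odd {x} x+y-odd x-even 2∣y = x+y-odd (∣m∣n⇒∣m+n (decidable-stable (2 ∣? x) x-even) 2∣y)

  -- Arithmetic of a single trapezoid

  firstPlusLast : ℕ → ℕ → ℕ → ℕ
  firstPlusLast k t a = 2 * a + (k ∸ 1) * t

  s-suc : ∀ k t a → s (suc k) t a ≡ s k t a + (a + k * t)
  s-suc k t a = begin
    sum (map term (upTo (suc k)))     ≡⟨ cong (λ l → sum (map term l)) (sym (upTo-∷ʳ k)) ⟩
    sum (map term (upTo k ∷ʳ k))      ≡⟨ cong sum (map-++ term (upTo k) (k ∷ [])) ⟩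
    sum (map term (upTo k) ∷ʳ term k) ≡⟨ sum-++ (map term (upTo k)) (term k ∷ []) ⟩
    s k t a + (a + k * t + 0)         ≡⟨ cong (s k t a +_) (ℕP.+-identityʳ _) ⟩
    s k t a + (a + k * t)             ∎
    where
    open ≡-Reasoning
    term : ℕ → ℕ
    term i = a + i * t

  s-double : ∀ k t a → 2 * s k t a ≡ k * firstPlusLast k t a
  s-double zero t a = refl
  s-double (suc k) t a = go k
    where
    go : ∀ k → 2 * s (suc k) t a ≡ suc k * (2 * a + k * t)
    go zero = base a t
      where
      base : ∀ a t → 2 * (a + 0 * t + 0) ≡ 1 * (2 * a + 0 * t)
      base = solve-∀
    go (suc k) = begin
      2 * s (suc (suc k)) t a                       ≡⟨ cong (2 *_) (s-suc (suc k) t a) ⟩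
      2 * (s (suc k) t a + (a + suc k * t))         ≡⟨ ℕP.*-distribˡ-+ 2 (s (suc k) t a) _ ⟩
      2 * s (suc k) t a + 2 * (a + suc k * t)       ≡⟨ cong (_+ 2 * (a + suc k * t)) (go k) ⟩
      suc k * (2 * a + k * t) + 2 * (a + suc k * t) ≡⟨ step k a t ⟩
      suc (suc k) * (2 * a + suc k * t)             ∎
      where
      open ≡-Reasoning
      step : ∀ k a t → suc k * (2 * a + k * t) + 2 * (a + suc k * t) ≡ suc (suc k) * (2 * a + suc k * t)
      step = solve-∀

  s≡⇒double : ∀ k t → s k t a ≡ n → 2 * n ≡ k * firstPlusLast k t a
  s≡⇒double {a} k t s≡n = trans (cong (2 *_) (sym s≡n)) (s-double k t a)

  s≡⇒nonZero : ∀ {k t} .{{_ : NonZero n}} → s k t a ≡ n → NonZero k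
  s≡⇒nonZero {k = zero} 0≡n = contradiction (sym 0≡n) (ℕ.≢-nonZero⁻¹ _)
  s≡⇒nonZero {k = suc _} _ = _

  s-injective : ∀ k t {a a′} .{{_ : NonZero k}} → s k t a ≡ s k t a′ → a ≡ a′
  s-injective k t {a} {a′} eq =
    ℕP.*-cancelˡ-≡ a a′ 2 (ℕP.+-cancelʳ-≡ ((k ∸ 1) * t) (2 * a) (2 * a′)
      (ℕP.*-cancelˡ-≡ _ _ k (trans (sym (s-double k t a)) (trans (cong (2 *_) eq) (s-double k t a′)))))

  s-parity : ∀ k t a .{{_ : NonZero k}} → Odd t → Odd (k + firstPlusLast k t a)
  s-parity (suc k) t a t-odd with odd⇒1+2* t-odd
  ... | u , refl = subst Odd (sym (rearrange k a u)) (odd-1+2* (k + a + k * u))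
    where
    rearrange : ∀ k a u → suc k + (2 * a + k * suc (2 * u)) ≡ suc (2 * (k + a + k * u))
    rearrange = solve-∀

  s≡⇒lengthBound : ∀ k t .{{_ : NonZero k}} → 1 ≤ a → s k t a ≡ n → k * (k ∸ 1) * t < 2 * n
  s≡⇒lengthBound {suc a′} {n} (suc k′) t _ s≡n = begin-strict
    suc k′ * k′ * t                            <⟨ ℕP.m<m+n _ (s≤s z≤n) ⟩
    suc k′ * k′ * t + suc k′ * (2 * suc a′)    ≡⟨ split k′ a′ t ⟩
    suc k′ * firstPlusLast (suc k′) t (suc a′) ≡⟨ sym (s≡⇒double (suc k′) t s≡n) ⟩
    2 * n                                      ∎
    where
    open ℕP.≤-Reasoning
    split : ∀ k′ a′ t → suc k′ * k′ * t + suc k′ * (2 * suc a′) ≡ suc k′ * (2 * suc a′ + k′ * t)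
    split = solve-∀

  s≡⇒firstPlusLastBound : ∀ k t .{{_ : NonZero k}} → 1 ≤ a → s k t a ≡ n →
                          let m = firstPlusLast k t a in 2 * n * t + 2 * m ≤ m * (m + t)
  s≡⇒firstPlusLastBound {a} {n} (suc k′) t 1≤a s≡n = begin
    2 * n * t + 2 * m
      ≤⟨ ℕP.+-monoʳ-≤ (2 * n * t) (ℕP.*-monoʳ-≤ 2 (ℕP.m≤m*n m a ⦃ ℕ.>-nonZero 1≤a ⦄)) ⟩
    2 * n * t + 2 * (m * a)      ≡⟨ cong (λ x → x * t + 2 * (m * a)) (s≡⇒double (suc k′) t s≡n) ⟩
    suc k′ * m * t + 2 * (m * a) ≡⟨ expand k′ a t ⟩
    m * (m + t)                  ∎
    where
    open ℕP.≤-Reasoning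
    m : ℕ
    m = firstPlusLast (suc k′) t a
    expand : ∀ k′ a t → let m = 2 * a + k′ * t in suc k′ * m * t + 2 * (m * a) ≡ m * (m + t)
    expand = solve-∀

  odd-length-∣ : ∀ {k} t → Odd k → s k t a ≡ n → k ∣ n
  odd-length-∣ {a} {n} t k-odd s≡n with odd⇒1+2* k-odd
  ... | e , refl = divides (a + e * t) (ℕP.*-cancelˡ-≡ n _ 2 (trans (s≡⇒double (suc (2 * e)) t s≡n) (regroup e a t)))
    where
    regroup : ∀ e a t → suc (2 * e) * (2 * a + 2 * e * t) ≡ 2 * ((a + e * t) * suc (2 * e))
    regroup = solve-∀

  even-length-∣ : ∀ {k} t → ¬ Odd k → s k t a ≡ n → firstPlusLast k t a ∣ n
  even-length-∣ {a} {n} t k-even s≡n with even⇒2* k-even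
  ... | q , refl = divides q (ℕP.*-cancelˡ-≡ n _ 2 (trans (s≡⇒double (2 * q) t s≡n) (ℕP.*-assoc 2 q _)))

  odd-divisor⇒lengthSolution : ∀ {d} t → Odd d → d ∣ n → d * (d ∸ 1) * t < 2 * n →
                               ∃[ a ] (1≤ a ≤ n × s d t a ≡ n)
  odd-divisor⇒lengthSolution {n} t d-odd d∣n bound with odd⇒1+2* d-odd | d∣n
  ... | e , refl | divides q n≡qd = a₀ , (ℕP.m<n⇒0<n∸m et<q , a₀≤n) , s≡n
    where
    d : ℕ
    d = suc (2 * e)
    et<q : e * t < q
    et<q = ℕP.*-cancelˡ-< 2 _ _ (ℕP.*-cancelˡ-< d _ _
             (subst₂ _<_ (reassoc d e t) (trans (cong (2 *_) n≡qd) (comm d q)) bound))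
      where
      reassoc : ∀ d e t → d * (2 * e) * t ≡ d * (2 * (e * t))
      reassoc = solve-∀
      comm : ∀ d q → 2 * (q * d) ≡ d * (2 * q)
      comm = solve-∀
    a₀ : ℕ
    a₀ = q ∸ e * t
    a₀≤n : a₀ ≤ n
    a₀≤n = ℕP.≤-trans (ℕP.m∸n≤m q (e * t)) (subst (q ≤_) (sym n≡qd) (ℕP.m≤m*n q d))
    s≡n : s d t a₀ ≡ n
    s≡n = ℕP.*-cancelˡ-≡ _ _ 2 (begin
      2 * s d t a₀                ≡⟨ s-double d t a₀ ⟩
      d * (2 * a₀ + 2 * e * t)    ≡⟨ regroup d a₀ e t ⟩
      2 * ((a₀ + e * t) * d)      ≡⟨ cong (λ x → 2 * (x * d)) (ℕP.m∸n+n≡m (ℕP.<⇒≤ et<q)) ⟩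
      2 * (q * d)                 ≡⟨ cong (2 *_) (sym n≡qd) ⟩
      2 * n                       ∎)
      where
      open ≡-Reasoning
      regroup : ∀ d a e t → d * (2 * a + 2 * e * t) ≡ 2 * ((a + e * t) * d)
      regroup = solve-∀

  -- With n = q d the length is 2q and the first term is (d - (2q - 1) t) / 2,
  -- which in terms of d = 2e + 1 and t = 2u + 1 is e - w.
  odd-divisor⇒firstPlusLastSolution :
    ∀ {d t} .{{_ : NonZero n}} → Odd d → Odd t → d ∣ n → 2 * n * t + 2 * d ≤ d * (d + t) →
    ∃[ k ] ∃[ a ] (1≤ k ≤ n × 1≤ a ≤ n × s k t a ≡ n × firstPlusLast k t a ≡ d)
  odd-divisor⇒firstPlusLastSolution d-odd t-odd d∣n bound with odd⇒1+2* d-odd | odd⇒1+2* t-odd | d∣n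
  ... | e , refl | u , refl | divides zero n≡0 = contradiction n≡0 (ℕ.≢-nonZero⁻¹ _)
  odd-divisor⇒firstPlusLastSolution {n} d-odd t-odd d∣n bound | e , refl | u , refl | divides q@(suc p) n≡qd =
    k₀ , a₀ , (s≤s z≤n , k₀≤n) , (ℕP.m<n⇒0<n∸m w<e , a₀≤n) , s≡n , fpl≡d
    where
    d t w k₀ a₀ : ℕ
    d = suc (2 * e)
    t = suc (2 * u)
    w = 2 * p * u + p + u
    k₀ = 2 * q
    a₀ = e ∸ w
    w<e : w < e
    w<e = ℕP.*-cancelˡ-≤ 2 (ℕP.≤-pred (ℕP.+-cancelʳ-≤ t _ _ (begin
      suc (2 * suc w) + t ≡⟨ expand p u ⟩
      2 * q * t + 2       ≤⟨ ℕP.*-cancelʳ-≤ _ _ d (subst₂ _≤_ (trans (cong (λ x → 2 * x * t + 2 * d) n≡qd)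
                                                                     (sym (factor q d t)))
                                                              (ℕP.*-comm d _) bound) ⟩
      d + t               ∎)))
      where
      open ℕP.≤-Reasoning
      expand : ∀ p u → suc (2 * suc (2 * p * u + p + u)) + suc (2 * u) ≡ 2 * suc p * suc (2 * u) + 2
      expand = solve-∀
      factor : ∀ q d t → (2 * q * t + 2) * d ≡ 2 * (q * d) * t + 2 * d
      factor = solve-∀
    a₀≤n : a₀ ≤ n
    a₀≤n = ℕP.≤-trans (ℕP.m∸n≤m e w) (ℕP.≤-trans (ℕP.m≤n⇒m≤1+n (ℕP.m≤m+n e (e + 0))) (∣⇒≤ d∣n))
    k₀≤n : k₀ ≤ n
    k₀≤n = begin
      2 * q ≡⟨ ℕP.*-comm 2 q ⟩
      q * 2 ≤⟨ ℕP.*-monoʳ-≤ q (s≤s (ℕP.≤-trans (ℕP.≤-trans (s≤s z≤n) w<e) (ℕP.m≤m+n e (e + 0)))) ⟩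
      q * d ≡⟨ sym n≡qd ⟩
      n     ∎
      where open ℕP.≤-Reasoning
    fpl≡d : firstPlusLast k₀ t a₀ ≡ d
    fpl≡d = begin
      2 * a₀ + (2 * q ∸ 1) * t           ≡⟨ cong (λ x → 2 * a₀ + x * t) (ℕP.+-suc p (p + 0)) ⟩
      2 * a₀ + suc (2 * p) * suc (2 * u) ≡⟨ regroup a₀ p u ⟩
      suc (2 * (a₀ + w))                 ≡⟨ cong (λ x → suc (2 * x)) (ℕP.m∸n+n≡m (ℕP.<⇒≤ w<e)) ⟩
      d                                  ∎
      where
      open ≡-Reasoning
      regroup : ∀ a p u → 2 * a + suc (2 * p) * suc (2 * u) ≡ suc (2 * (a + (2 * p * u + p + u)))
      regroup = solve-∀
    s≡n : s k₀ t a₀ ≡ n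
    s≡n = ℕP.*-cancelˡ-≡ _ _ 2 (begin
      2 * s k₀ t a₀               ≡⟨ s-double k₀ t a₀ ⟩
      k₀ * firstPlusLast k₀ t a₀  ≡⟨ cong (k₀ *_) fpl≡d ⟩
      2 * q * d                   ≡⟨ ℕP.*-assoc 2 q d ⟩
      2 * (q * d)                 ≡⟨ cong (2 *_) (sym n≡qd) ⟩
      2 * n                       ∎)
      where open ≡-Reasoning

  -- The thresholds θ and ψ

  toℚᵘ-/ : ∀ i k → ℚ.toℚᵘ (i ℚ./ suc k) ≃ mkℚᵘ i k
  toℚᵘ-/ i k = ℚP.toℚᵘ-fromℚᵘ (mkℚᵘ i k)

  toℚᵘ-+-cong : ∀ {x y X Y} → ℚ.toℚᵘ x ≃ X → ℚ.toℚᵘ y ≃ Y → ℚ.toℚᵘ (x ℚ.+ y) ≃ X ℚᵘ.+ Y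
  toℚᵘ-+-cong {x} {y} x≃X y≃Y = ℚᵘP.≃-trans (ℚP.toℚᵘ-homo-+ x y) (ℚᵘP.+-cong x≃X y≃Y)

  toℚᵘ-*-cong : ∀ {x y X Y} → ℚ.toℚᵘ x ≃ X → ℚ.toℚᵘ y ≃ Y → ℚ.toℚᵘ (x ℚ.* y) ≃ X ℚᵘ.* Y
  toℚᵘ-*-cong {x} {y} x≃X y≃Y = ℚᵘP.≃-trans (ℚP.toℚᵘ-homo-* x y) (ℚᵘP.*-cong x≃X y≃Y)

  toℚᵘ-neg-cong : ∀ {x X} → ℚ.toℚᵘ x ≃ X → ℚ.toℚᵘ (ℚ.- x) ≃ ℚᵘ.- X
  toℚᵘ-neg-cong {x} x≃X = ℚᵘP.≃-trans (ℚP.toℚᵘ-homo‿- x) (ℚᵘP.-‿cong x≃X)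

  toℚᵘ-<⇔ : ∀ {x y X Y} → ℚ.toℚᵘ x ≃ X → ℚ.toℚᵘ y ≃ Y → (x ℚ.< y) ⇔ (X ℚᵘ.< Y)
  toℚᵘ-<⇔ x≃X y≃Y = mk⇔
    (λ x<y → ℚᵘP.<-respˡ-≃ x≃X (ℚᵘP.<-respʳ-≃ y≃Y (ℚP.toℚᵘ-mono-< x<y)))
    (λ X<Y → ℚP.toℚᵘ-cancel-< (ℚᵘP.<-respˡ-≃ (ℚᵘP.≃-sym x≃X) (ℚᵘP.<-respʳ-≃ (ℚᵘP.≃-sym y≃Y) X<Y)))

  <√⇔ᵘ : ∀ x q r {X Q} → ℚ.toℚᵘ (x ℚ.- r) ≃ X → ℚ.toℚᵘ q ≃ Q → ¬ (X ℚᵘ.< 0ℚᵘ) →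
         (x <√ q + r) ⇔ (X ℚᵘ.* X ℚᵘ.< Q)
  <√⇔ᵘ x q r {X} {Q} x-r≃X q≃Q X≮0 = mk⇔ to (inj₂ ∘ Equivalence.from square<⇔)
    where
    square<⇔ : ((x ℚ.- r) ℚ.* (x ℚ.- r) ℚ.< q) ⇔ (X ℚᵘ.* X ℚᵘ.< Q)
    square<⇔ = toℚᵘ-<⇔ (toℚᵘ-*-cong x-r≃X x-r≃X) q≃Q
    to : x <√ q + r → X ℚᵘ.* X ℚᵘ.< Q
    to (inj₁ x-r<0) = contradiction (Equivalence.to (toℚᵘ-<⇔ {y = 0ℚ} x-r≃X ℚᵘP.≃-refl) x-r<0) X≮0
    to (inj₂ square<q) = Equivalence.to square<⇔ square<q

  <ᵘ⇔<-cross : ∀ {p q a b} → ↥ p ℤ.* ↧ q ≡ ℤ.+ a → ↥ q ℤ.* ↧ p ≡ ℤ.+ b → (p ℚᵘ.< q) ⇔ (a < b)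
  <ᵘ⇔<-cross pq≡a qp≡b = mk⇔
    (λ { (ℚᵘ.*<* pq<qp) → ℤP.drop‿+<+ (subst₂ ℤ._<_ pq≡a qp≡b pq<qp) })
    (λ a<b → ℚᵘ.*<* (subst₂ ℤ._<_ (sym pq≡a) (sym qp≡b) (ℤ.+<+ a<b)))

  scale-<⇔ : ∀ {a b l r} x y c .{{_ : NonZero c}} → a + x ≡ c * l + y → b + x ≡ c * r + y → (a < b) ⇔ (l < r)
  scale-<⇔ {a} {b} {l} {r} x y c a≡ b≡ = mk⇔
    (λ a<b → ℕP.*-cancelˡ-< c l r (ℕP.+-cancelʳ-< y _ _ (subst₂ _<_ a≡ b≡ (ℕP.+-monoˡ-< x a<b))))
    (λ l<r → ℕP.+-cancelʳ-< x a b (subst₂ _<_ (sym a≡) (sym b≡) (ℕP.+-monoˡ-< y (ℕP.*-monoʳ-< c l<r))))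

  -- Once d, t, n are successors both sides of these ℚᵘ inequalities normalise to
  -- ℕ numerators; lhs and rhs write those normal forms as 16 · (bound) + shift.
  private
    d-½ : ℕ → ℚᵘ
    d-½ d = mkℚᵘ (ℤ.+ d) 0 ℚᵘ.- mkℚᵘ (ℤ.+ 1) 1

    θ-radᵘ : ℕ → ℕ → ℚᵘ
    θ-radᵘ t n = mkℚᵘ (ℤ.+ (2 * n)) (t ∸ 1) ℚᵘ.+ mkℚᵘ (ℤ.+ 1) 3

    d-½≮0 : ∀ d .{{_ : NonZero d}} → ¬ (d-½ d ℚᵘ.< 0ℚᵘ)
    d-½≮0 (suc e) (ℚᵘ.*<* (ℤ.+<+ ()))

    d-½²<θ-rad⇔ : ∀ d t n .{{_ : NonZero d}} .{{_ : NonZero t}} .{{_ : NonZero n}} →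
                  (d-½ d ℚᵘ.* d-½ d ℚᵘ.< θ-radᵘ t n) ⇔ (d * (d ∸ 1) * t < 2 * n)
    d-½²<θ-rad⇔ (suc e) (suc t′) (suc n′) =
      ⇔-trans (<ᵘ⇔<-cross refl refl) (scale-<⇔ 0 (4 * suc t′) 16 (lhs e t′) (rhs n′ t′))
      where
      lhs : ∀ e t′ → 4 + t′ * 4 + (e * 2 + e * 2 * suc (e * 2)) * (4 + t′ * 4) + 0 ≡ 16 * (suc e * e * suc t′) + 4 * suc t′
      lhs = solve-∀
      rhs : ∀ n′ t′ → 16 + ((n′ + 1 * suc n′) * 4 + suc (t′ + 0 * suc t′)) * 4 + 0 ≡ 16 * (2 * suc n′) + 4 * suc t′
      rhs = solve-∀

  θ-bound⇔ : ∀ d t n .{{_ : NonZero d}} .{{_ : NonZero t}} .{{_ : NonZero n}} →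
             (ℕtoℚ d <√ θ-rad t n + θ-off) ⇔ (d * (d ∸ 1) * t < 2 * n)
  θ-bound⇔ d t@(suc t′) n = ⇔-trans (<√⇔ᵘ (ℕtoℚ d) (θ-rad t n) θ-off d-½≃ rad≃ (d-½≮0 d)) (d-½²<θ-rad⇔ d t n)
    where
    d-½≃ : ℚ.toℚᵘ (ℕtoℚ d ℚ.- θ-off) ≃ d-½ d
    d-½≃ = toℚᵘ-+-cong (toℚᵘ-/ (ℤ.+ d) 0) (toℚᵘ-neg-cong {θ-off} ℚᵘP.≃-refl)
    rad≃ : ℚ.toℚᵘ (θ-rad t n) ≃ θ-radᵘ t n
    rad≃ = toℚᵘ-+-cong (toℚᵘ-/ (ℤ.+ (2 * n)) t′) (toℚᵘ-/ (ℤ.+ 1) 3)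

  private
    half-t-2ᵘ : ℕ → ℚᵘ
    half-t-2ᵘ t = mkℚᵘ (ℤ.+ t ℤ.- ℤ.+ 2) 1

    d+half-t-2 : ℕ → ℕ → ℚᵘ
    d+half-t-2 d t = mkℚᵘ (ℤ.+ d) 0 ℚᵘ.- (ℚᵘ.- half-t-2ᵘ t)

    ψ-radᵘ : ℕ → ℕ → ℚᵘ
    ψ-radᵘ t n = mkℚᵘ (ℤ.+ (2 * n * t)) 0 ℚᵘ.+ half-t-2ᵘ t ℚᵘ.* half-t-2ᵘ t

    -- (t - 2) / 2 only normalises once t is split into 1, 2 and 3 + w.
    d+half-t-2≮0 : ∀ d t .{{_ : NonZero d}} .{{_ : NonZero t}} → ¬ (d+half-t-2 d t ℚᵘ.< 0ℚᵘ)
    d+half-t-2≮0 (suc e) 1 (ℚᵘ.*<* (ℤ.+<+ ()))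
    d+half-t-2≮0 (suc e) 2 (ℚᵘ.*<* (ℤ.+<+ ()))
    d+half-t-2≮0 (suc e) (suc (suc (suc w))) (ℚᵘ.*<* (ℤ.+<+ ()))

    d+half-t-2²<ψ-rad⇔ : ∀ d t n .{{_ : NonZero d}} .{{_ : NonZero t}} .{{_ : NonZero n}} →
                         (d+half-t-2 d t ℚᵘ.* d+half-t-2 d t ℚᵘ.< ψ-radᵘ t n) ⇔ (d * (d + t) < 2 * n * t + 2 * d)
    d+half-t-2²<ψ-rad⇔ (suc e) 1 (suc n′) =
      ⇔-trans (<ᵘ⇔<-cross refl refl) (scale-<⇔ (32 * e + 28) 0 16 (lhs e) (rhs e n′))
      where
      lhs : ∀ e → 4 + (e * 2 + e * 2 * suc (e * 2)) * 4 + (32 * e + 28) ≡ 16 * (suc e * (suc e + 1)) + 0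
      lhs = solve-∀
      rhs : ∀ e n′ → 16 + ((n′ + 1 * suc n′) * 1 * 4 + 1) * 4 + (32 * e + 28) ≡ 16 * (2 * suc n′ * 1 + 2 * suc e) + 0
      rhs = solve-∀
    d+half-t-2²<ψ-rad⇔ (suc e) 2 (suc n′) =
      ⇔-trans (<ᵘ⇔<-cross refl refl) (scale-<⇔ (32 * e + 32) 0 16 (lhs e) (rhs e n′))
      where
      lhs : ∀ e → 8 + (e * 2 + 0 + suc (e * 2 + 0) * suc (suc (e * 2 + 0))) * 4 + (32 * e + 32) ≡ 16 * (suc e * (suc e + 2)) + 0
      lhs = solve-∀
      rhs : ∀ e n′ → 32 + ((n′ + 1 * suc n′) * 2 * 4 + 0) * 4 + (32 * e + 32) ≡ 16 * (2 * suc n′ * 2 + 2 * suc e) + 0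
      rhs = solve-∀
    d+half-t-2²<ψ-rad⇔ (suc e) (suc (suc (suc w))) (suc n′) =
      ⇔-trans (<ᵘ⇔<-cross refl refl) (scale-<⇔ (32 * e + 28) (4 * w * w + 8 * w) 16 (lhs e w) (rhs e w n′))
      where
      lhs : ∀ e w → 8 + (e * 2 + suc (w * 1) + suc (e * 2 + suc (w * 1)) * suc (suc (e * 2 + suc (w * 1)))) * 4 + (32 * e + 28)
                    ≡ 16 * (suc e * (suc e + suc (suc (suc w)))) + (4 * w * w + 8 * w)
      lhs = solve-∀
      rhs : ∀ e w n′ → 48 + ((w + (n′ + 1 * suc n′) * suc (suc (suc w))) * 4 + suc ((w + w * suc w) * 1)) * 4 + (32 * e + 28)
                       ≡ 16 * (2 * suc n′ * suc (suc (suc w)) + 2 * suc e) + (4 * w * w + 8 * w)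
      rhs = solve-∀

  ψ-bound⇔ : ∀ d t n .{{_ : NonZero d}} .{{_ : NonZero t}} .{{_ : NonZero n}} →
             (ℕtoℚ d <√ ψ-rad t n + ψ-off t) ⇔ (d * (d + t) < 2 * n * t + 2 * d)
  ψ-bound⇔ d t n =
    ⇔-trans (<√⇔ᵘ (ℕtoℚ d) (ψ-rad t n) (ψ-off t) d+half≃ rad≃ (d+half-t-2≮0 d t)) (d+half-t-2²<ψ-rad⇔ d t n)
    where
    half≃ : ℚ.toℚᵘ (half-t-2 t) ≃ half-t-2ᵘ t
    half≃ = toℚᵘ-/ (ℤ.+ t ℤ.- ℤ.+ 2) 1
    d+half≃ : ℚ.toℚᵘ (ℕtoℚ d ℚ.- ψ-off t) ≃ d+half-t-2 d t
    d+half≃ = toℚᵘ-+-cong (toℚᵘ-/ (ℤ.+ d) 0) (toℚᵘ-neg-cong (toℚᵘ-neg-cong half≃))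
    rad≃ : ℚ.toℚᵘ (ψ-rad t n) ≃ ψ-radᵘ t n
    rad≃ = toℚᵘ-+-cong (toℚᵘ-/ (ℤ.+ (2 * n * t)) 0) (toℚᵘ-*-cong half≃ half≃)

  -- Counting representations by odd divisors

  module Counting (t n : ℕ) .{{_ : NonZero t}} (t-odd : Odd t) .{{_ : NonZero n}} where

    OddDivisor : ℕ → Set
    OddDivisor d = Odd d × d ∣ n

    oddDivisor? : ∀ d → Dec (OddDivisor d)
    oddDivisor? d = odd? d ×-dec d ∣? n

    -- d < θ_t(n) and d ≥ ψ_t(n) respectively, by θ-bound⇔ and ψ-bound⇔.
    LengthBound FirstPlusLastBound : ℕ → Set
    LengthBound d = d * (d ∸ 1) * t < 2 * n
    FirstPlusLastBound d = 2 * n * t + 2 * d ≤ d * (d + t)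

    lengthBound? : ∀ d → Dec (LengthBound d)
    lengthBound? d = d * (d ∸ 1) * t ℕP.<? 2 * n

    firstPlusLastBound? : ∀ d → Dec (FirstPlusLastBound d)
    firstPlusLastBound? d = 2 * n * t + 2 * d ℕP.≤? d * (d + t)

    -- The odd factor d of 2n = k · firstPlusLast k t a labels the representation (k , a).
    OddLength OddFirstPlusLast : ℕ → ℕ → ℕ → Set
    OddLength k a d = s k t a ≡ n × Odd d × d ≡ k
    OddFirstPlusLast k a d = s k t a ≡ n × Odd d × d ≡ firstPlusLast k t a

    oddLength? : ∀ k a d → Dec (OddLength k a d)
    oddLength? k a d = s k t a ℕ.≟ n ×-dec odd? d ×-dec d ℕ.≟ k

    oddFirstPlusLast? : ∀ k a d → Dec (OddFirstPlusLast k a d)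
    oddFirstPlusLast? k a d = s k t a ℕ.≟ n ×-dec odd? d ×-dec d ℕ.≟ firstPlusLast k t a

    odd-length⇒even-firstPlusLast : ∀ {k a} → s k t a ≡ n → Odd k → ¬ Odd (firstPlusLast k t a)
    odd-length⇒even-firstPlusLast {k} {a} s≡n = odd-+-odd⇒even (s-parity k t a ⦃ s≡⇒nonZero s≡n ⦄ t-odd)

    even-length⇒odd-firstPlusLast : ∀ {k a} → s k t a ≡ n → ¬ Odd k → Odd (firstPlusLast k t a)
    even-length⇒odd-firstPlusLast {k} {a} s≡n = odd-+-even⇒odd (s-parity k t a ⦃ s≡⇒nonZero s≡n ⦄ t-odd)

    ¬oddLength×oddFirstPlusLast : ∀ {k a d} → ¬ (OddLength k a d × OddFirstPlusLast k a d)
    ¬oddLength×oddFirstPlusLast ((s≡n , d-odd , refl) , (_ , _ , d≡m)) =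
      odd-length⇒even-firstPlusLast s≡n d-odd (subst Odd d≡m d-odd)

    Phi⁺≡∑ : Phi⁺ t n ≡ ∑[ 1≤ k ≤ n ] ∑[ 1≤ a ≤ n ] 𝟙 (s k t a ℕ.≟ n)
    Phi⁺≡∑ = begin
      Phi⁺ t n
        ≡⟨ length-filter solution? (pairs n) ⟩
      sum (map (𝟙 ∘ solution?) (pairs n))
        ≡⟨ sum-map-concatMap (𝟙 ∘ solution?) (λ k → map (k ,_) (range1 n)) (range1 n) ⟩
      sum (map (λ k → sum (map (𝟙 ∘ solution?) (map (k ,_) (range1 n)))) (range1 n))
        ≡⟨ cong sum (map-cong (λ k → trans (cong sum (sym (map-∘ (range1 n)))) (sum-map-range1 _ n)) (range1 n)) ⟩
      sum (map (λ k → ∑[ 1≤ a ≤ n ] 𝟙 (s k t a ℕ.≟ n)) (range1 n))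
        ≡⟨ sum-map-range1 _ n ⟩
      ∑[ 1≤ k ≤ n ] ∑[ 1≤ a ≤ n ] 𝟙 (s k t a ℕ.≟ n) ∎
      where
      open ≡-Reasoning
      solution? : ∀ (p : ℕ × ℕ) → Dec (s (proj₁ p) t (proj₂ p) ≡ n)
      solution? (k , a) = s k t a ℕ.≟ n

    solution≡∑oddFactors : ∀ k a → 1≤ k ≤ n →
      𝟙 (s k t a ℕ.≟ n) ≡ ∑[ 1≤ d ≤ n ] 𝟙 (oddLength? k a d ⊎-dec oddFirstPlusLast? k a d)
    solution≡∑oddFactors k a k∈ = sym (∑₁-𝟙-unique n (λ d → oddLength? k a d ⊎-dec oddFirstPlusLast? k a d)
                                         (s k t a ℕ.≟ n) unique (λ _ _ → [ proj₁ , proj₁ ]) complete)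
      where
      unique : ∀ {d d′} → OddLength k a d ⊎ OddFirstPlusLast k a d →
                          OddLength k a d′ ⊎ OddFirstPlusLast k a d′ → d ≡ d′
      unique (inj₁ (_ , _ , refl)) (inj₁ (_ , _ , refl)) = refl
      unique (inj₂ (_ , _ , refl)) (inj₂ (_ , _ , refl)) = refl
      unique (inj₁ (s≡n , k-odd , refl)) (inj₂ (_ , m-odd , refl)) =
        contradiction m-odd (odd-length⇒even-firstPlusLast s≡n k-odd)
      unique (inj₂ (s≡n , m-odd , refl)) (inj₁ (_ , k-odd , refl)) =
        contradiction m-odd (odd-length⇒even-firstPlusLast s≡n k-odd)
      complete : s k t a ≡ n → ∃[ d ] (1≤ d ≤ n × (OddLength k a d ⊎ OddFirstPlusLast k a d))
      complete s≡n with odd? k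
      ... | yes k-odd = k , k∈ , inj₁ (s≡n , k-odd , refl)
      ... | no k-even =
        m , (ℕ.>-nonZero⁻¹ m ⦃ odd⇒nonZero m-odd ⦄ , ∣⇒≤ (even-length-∣ t k-even s≡n)) , inj₂ (s≡n , m-odd , refl)
        where
        m : ℕ
        m = firstPlusLast k t a
        m-odd : Odd m
        m-odd = even-length⇒odd-firstPlusLast s≡n k-even

    ∑oddLength : ∀ d → ∑[ 1≤ k ≤ n ] ∑[ 1≤ a ≤ n ] 𝟙 (oddLength? k a d) ≡ 𝟙 (oddDivisor? d ×-dec lengthBound? d)
    ∑oddLength d = ∑₁²-𝟙-unique n (λ k a → oddLength? k a d) (oddDivisor? d ×-dec lengthBound? d) unique sound complete
      where
      unique : ∀ {k a k′ a′} → OddLength k a d → OddLength k′ a′ d → k ≡ k′ × a ≡ a′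
      unique (s≡n , _ , refl) (s′≡n , _ , refl) = refl , s-injective d t ⦃ s≡⇒nonZero s≡n ⦄ (trans s≡n (sym s′≡n))
      sound : ∀ k a → 1≤ k ≤ n → 1≤ a ≤ n → OddLength k a d → OddDivisor d × LengthBound d
      sound k a _ (1≤a , _) (s≡n , d-odd , refl) =
        (d-odd , odd-length-∣ t d-odd s≡n) , s≡⇒lengthBound d t ⦃ s≡⇒nonZero s≡n ⦄ 1≤a s≡n
      complete : OddDivisor d × LengthBound d → ∃[ k ] ∃[ a ] (1≤ k ≤ n × 1≤ a ≤ n × OddLength k a d)
      complete ((d-odd , d∣n) , bound) with odd-divisor⇒lengthSolution t d-odd d∣n bound
      ... | a , a∈ , s≡n = d , a , (ℕ.>-nonZero⁻¹ d ⦃ odd⇒nonZero d-odd ⦄ , ∣⇒≤ d∣n) , a∈ , s≡n , d-odd , refl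

    ∑oddFirstPlusLast : ∀ d → ∑[ 1≤ k ≤ n ] ∑[ 1≤ a ≤ n ] 𝟙 (oddFirstPlusLast? k a d)
                              ≡ 𝟙 (oddDivisor? d ×-dec firstPlusLastBound? d)
    ∑oddFirstPlusLast d =
      ∑₁²-𝟙-unique n (λ k a → oddFirstPlusLast? k a d) (oddDivisor? d ×-dec firstPlusLastBound? d) unique sound complete
      where
      unique : ∀ {k a k′ a′} → OddFirstPlusLast k a d → OddFirstPlusLast k′ a′ d → k ≡ k′ × a ≡ a′
      unique {k} {a} {k′} {a′} (s≡n , d-odd , d≡m) (s′≡n , _ , d≡m′) = k≡k′ , a≡a′
        where
        k≡k′ : k ≡ k′
        k≡k′ = ℕP.*-cancelʳ-≡ k k′ d ⦃ odd⇒nonZero d-odd ⦄ (begin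
          k * d                      ≡⟨ cong (k *_) d≡m ⟩
          k * firstPlusLast k t a    ≡⟨ sym (s≡⇒double k t s≡n) ⟩
          2 * n                      ≡⟨ s≡⇒double k′ t s′≡n ⟩
          k′ * firstPlusLast k′ t a′ ≡⟨ cong (k′ *_) (sym d≡m′) ⟩
          k′ * d                     ∎)
          where open ≡-Reasoning
        a≡a′ : a ≡ a′
        a≡a′ = s-injective k′ t ⦃ s≡⇒nonZero s′≡n ⦄ (trans (subst (λ x → s x t a ≡ n) k≡k′ s≡n) (sym s′≡n))
      sound : ∀ k a → 1≤ k ≤ n → 1≤ a ≤ n → OddFirstPlusLast k a d → OddDivisor d × FirstPlusLastBound d
      sound k a _ (1≤a , _) (s≡n , m-odd , refl) =
        (m-odd , even-length-∣ t k-even s≡n) , s≡⇒firstPlusLastBound k t ⦃ s≡⇒nonZero s≡n ⦄ 1≤a s≡n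
        where
        k-even : ¬ Odd k
        k-even k-odd = odd-length⇒even-firstPlusLast s≡n k-odd m-odd
      complete : OddDivisor d × FirstPlusLastBound d →
                 ∃[ k ] ∃[ a ] (1≤ k ≤ n × 1≤ a ≤ n × OddFirstPlusLast k a d)
      complete ((d-odd , d∣n) , bound) with odd-divisor⇒firstPlusLastSolution d-odd t-odd d∣n bound
      ... | k , a , k∈ , a∈ , s≡n , m≡d = k , a , k∈ , a∈ , s≡n , d-odd , sym m≡d

    ∑oddFactors : ∀ d → ∑[ 1≤ k ≤ n ] ∑[ 1≤ a ≤ n ] 𝟙 (oddLength? k a d ⊎-dec oddFirstPlusLast? k a d)
                        ≡ 𝟙 (oddDivisor? d ×-dec lengthBound? d) + 𝟙 (oddDivisor? d ×-dec firstPlusLastBound? d)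
    ∑oddFactors d = begin
      ∑[ 1≤ k ≤ n ] ∑[ 1≤ a ≤ n ] 𝟙 (oddLength? k a d ⊎-dec oddFirstPlusLast? k a d)
        ≡⟨ ∑₁-cong n (λ k _ → ∑₁-cong n λ a _ →
             𝟙-⊎ (oddLength? k a d) (oddFirstPlusLast? k a d) ¬oddLength×oddFirstPlusLast) ⟩
      ∑[ 1≤ k ≤ n ] ∑[ 1≤ a ≤ n ] (𝟙 (oddLength? k a d) + 𝟙 (oddFirstPlusLast? k a d))
        ≡⟨ ∑₁-cong n (λ k _ → ∑₁-distrib-+ n _ _) ⟩
      ∑[ 1≤ k ≤ n ] (∑[ 1≤ a ≤ n ] 𝟙 (oddLength? k a d) + ∑[ 1≤ a ≤ n ] 𝟙 (oddFirstPlusLast? k a d))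
        ≡⟨ ∑₁-distrib-+ n _ _ ⟩
      ∑[ 1≤ k ≤ n ] ∑[ 1≤ a ≤ n ] 𝟙 (oddLength? k a d) + ∑[ 1≤ k ≤ n ] ∑[ 1≤ a ≤ n ] 𝟙 (oddFirstPlusLast? k a d)
        ≡⟨ cong₂ _+_ (∑oddLength d) (∑oddFirstPlusLast d) ⟩
      𝟙 (oddDivisor? d ×-dec lengthBound? d) + 𝟙 (oddDivisor? d ×-dec firstPlusLastBound? d) ∎
      where open ≡-Reasoning

    Phi⁺≡∑oddDivisors : Phi⁺ t n ≡ ∑[ 1≤ d ≤ n ] (𝟙 (oddDivisor? d ×-dec lengthBound? d)
                                                   + 𝟙 (oddDivisor? d ×-dec firstPlusLastBound? d))
    Phi⁺≡∑oddDivisors = begin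
      Phi⁺ t n
        ≡⟨ Phi⁺≡∑ ⟩
      ∑[ 1≤ k ≤ n ] ∑[ 1≤ a ≤ n ] 𝟙 (s k t a ℕ.≟ n)
        ≡⟨ ∑₁-cong n (λ k k∈ → ∑₁-cong n λ a _ → solution≡∑oddFactors k a k∈) ⟩
      ∑[ 1≤ k ≤ n ] ∑[ 1≤ a ≤ n ] ∑[ 1≤ d ≤ n ] F k a d
        ≡⟨ ∑₁-cong n (λ k _ → ∑₁-comm n n (F k)) ⟩
      ∑[ 1≤ k ≤ n ] ∑[ 1≤ d ≤ n ] ∑[ 1≤ a ≤ n ] F k a d
        ≡⟨ ∑₁-comm n n (λ k d → ∑[ 1≤ a ≤ n ] F k a d) ⟩
      ∑[ 1≤ d ≤ n ] ∑[ 1≤ k ≤ n ] ∑[ 1≤ a ≤ n ] F k a d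
        ≡⟨ ∑₁-cong n (λ d _ → ∑oddFactors d) ⟩
      ∑[ 1≤ d ≤ n ] (𝟙 (oddDivisor? d ×-dec lengthBound? d) + 𝟙 (oddDivisor? d ×-dec firstPlusLastBound? d))
        ∎
      where
      open ≡-Reasoning
      F : ℕ → ℕ → ℕ → ℕ
      F k a d = 𝟙 (oddLength? k a d ⊎-dec oddFirstPlusLast? k a d)

    θ? : ∀ d → Dec (ℕtoℚ d <√ θ-rad t n + θ-off)
    θ? d = ℕtoℚ d <√? θ-rad t n + θ-off

    ψ? : ∀ d → Dec (ℕtoℚ d <√ ψ-rad t n + ψ-off t)
    ψ? d = ℕtoℚ d <√? ψ-rad t n + ψ-off t

    odd-divisor-identity : ∀ d → 1 ≤ d →
      𝟙 (oddDivisor? d ×-dec lengthBound? d) + 𝟙 (oddDivisor? d ×-dec firstPlusLastBound? d) + 𝟙 (oddDivisor? d) * 𝟙 (ψ? d)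
      ≡ 𝟙 (oddDivisor? d) + 𝟙 (oddDivisor? d) * 𝟙 (θ? d)
    odd-divisor-identity d 1≤d = begin
      𝟙 (O ×-dec L) + 𝟙 (O ×-dec F) + o * 𝟙 (ψ? d)
        ≡⟨ cong₂ (λ x y → x + y + o * 𝟙 (ψ? d)) (𝟙-× O L) (𝟙-× O F) ⟩
      o * 𝟙 L + o * 𝟙 F + o * 𝟙 (ψ? d)
        ≡⟨ regroup o (𝟙 L) (𝟙 F) (𝟙 (ψ? d)) ⟩
      o * (𝟙 F + 𝟙 (ψ? d)) + o * 𝟙 L
        ≡⟨ cong₂ (λ x y → o * x + o * y) F+ψ≡1 L≡θ ⟩
      o * 1 + o * 𝟙 (θ? d)
        ≡⟨ cong (_+ o * 𝟙 (θ? d)) (ℕP.*-identityʳ o) ⟩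
      o + o * 𝟙 (θ? d) ∎
      where
      open ≡-Reasoning
      instance
        d≢0 : NonZero d
        d≢0 = ℕ.>-nonZero 1≤d
      O : Dec (OddDivisor d)
      O = oddDivisor? d
      L : Dec (LengthBound d)
      L = lengthBound? d
      F : Dec (FirstPlusLastBound d)
      F = firstPlusLastBound? d
      o : ℕ
      o = 𝟙 O
      regroup : ∀ o l f p → o * l + o * f + o * p ≡ o * (f + p) + o * l
      regroup = solve-∀
      L≡θ : 𝟙 L ≡ 𝟙 (θ? d)
      L≡θ = 𝟙-⇔ L (θ? d) (Equivalence.from (θ-bound⇔ d t n)) (Equivalence.to (θ-bound⇔ d t n))
      F+ψ≡1 : 𝟙 F + 𝟙 (ψ? d) ≡ 1
      F+ψ≡1 = 𝟙-complement F (ψ? d)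
        (λ bound below → ℕP.<⇒≱ (Equivalence.to (ψ-bound⇔ d t n) below) bound)
        (λ ¬bound → Equivalence.from (ψ-bound⇔ d t n) (ℕP.≰⇒> ¬bound))

    d₁≡∑ : d₁ n ≡ ∑[ 1≤ d ≤ n ] 𝟙 (oddDivisor? d)
    d₁≡∑ = trans (length-filter oddDivisor? (range1 n)) (sum-map-range1 _ n)

    d₁<≡∑ : ∀ {P : ℕ → Set} (P? : ∀ d → Dec (P d)) →
            d₁< n P P? ≡ ∑[ 1≤ d ≤ n ] (𝟙 (oddDivisor? d) * 𝟙 (P? d))
    d₁<≡∑ P? = begin
      length (filter P? (oddDivisors n))                               ≡⟨ length-filter P? (oddDivisors n) ⟩
      sum (map (𝟙 ∘ P?) (filter oddDivisor? (range1 n)))               ≡⟨ sum-map-filter oddDivisor? (𝟙 ∘ P?) (range1 n) ⟩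
      sum (map (λ d → 𝟙 (oddDivisor? d) * 𝟙 (P? d)) (range1 n))       ≡⟨ sum-map-range1 _ n ⟩
      ∑[ 1≤ d ≤ n ] (𝟙 (oddDivisor? d) * 𝟙 (P? d))                      ∎
      where open ≡-Reasoning

    count-identity : Phi⁺ t n + d₁ψ t n ≡ d₁ n + d₁θ t n
    count-identity = begin
      Phi⁺ t n + d₁ψ t n
        ≡⟨ cong₂ _+_ Phi⁺≡∑oddDivisors (d₁<≡∑ ψ?) ⟩
      ∑[ 1≤ d ≤ n ] (𝟙 (O d ×-dec L d) + 𝟙 (O d ×-dec F d)) + ∑[ 1≤ d ≤ n ] (𝟙 (O d) * 𝟙 (ψ? d))
        ≡⟨ sym (∑₁-distrib-+ n _ _) ⟩
      ∑[ 1≤ d ≤ n ] (𝟙 (O d ×-dec L d) + 𝟙 (O d ×-dec F d) + 𝟙 (O d) * 𝟙 (ψ? d))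
        ≡⟨ ∑₁-cong n (λ d (1≤d , _) → odd-divisor-identity d 1≤d) ⟩
      ∑[ 1≤ d ≤ n ] (𝟙 (O d) + 𝟙 (O d) * 𝟙 (θ? d))
        ≡⟨ ∑₁-distrib-+ n _ _ ⟩
      ∑[ 1≤ d ≤ n ] 𝟙 (O d) + ∑[ 1≤ d ≤ n ] (𝟙 (O d) * 𝟙 (θ? d))
        ≡⟨ sym (cong₂ _+_ d₁≡∑ (d₁<≡∑ θ?)) ⟩
      d₁ n + d₁θ t n ∎
      where
      open ≡-Reasoning
      O : ∀ d → Dec (OddDivisor d)
      O = oddDivisor?
      L : ∀ d → Dec (LengthBound d)
      L = lengthBound?
      F : ∀ d → Dec (FirstPlusLastBound d)
      F = firstPlusLastBound?

open import Data.Integer using (+_; _+_; _-_)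
open import Data.Integer.Properties using (pos-+; +-0-abelianGroup)
open import Algebra.Properties.AbelianGroup +-0-abelianGroup using (//-rightDividesʳ)
open import Relation.Binary.PropositionalEquality using (sym; cong; module ≡-Reasoning)

theorem6 : (t n : ℕ) → .{{_ : NonZero t}} → Odd t → .{{_ : NonZero n}} →
    + Phi⁺ t n ≡ (+ d₁ n + + d₁θ t n) - + d₁ψ t n
theorem6 t n t-odd = begin
  + Phi⁺ t n                           ≡⟨ sym (//-rightDividesʳ (+ d₁ψ t n) (+ Phi⁺ t n)) ⟩
  + Phi⁺ t n + + d₁ψ t n - + d₁ψ t n   ≡⟨ cong (_- + d₁ψ t n) (sym (pos-+ (Phi⁺ t n) (d₁ψ t n))) ⟩
  + (Phi⁺ t n ℕ.+ d₁ψ t n) - + d₁ψ t n ≡⟨ cong (λ m → + m - + d₁ψ t n) (Counting.count-identity t n t-odd) ⟩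
  + (d₁ n ℕ.+ d₁θ t n) - + d₁ψ t n     ≡⟨ cong (_- + d₁ψ t n) (pos-+ (d₁ n) (d₁θ t n)) ⟩
  + d₁ n + + d₁θ t n - + d₁ψ t n       ∎
  where open ≡-Reasoning
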